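{- Let $s$ be a nonzero integer and $n \ge 2$, and consider the Diophantine equation $$ \frac{1}{x_1} + \frac{1}{x_2} + \cdots + \frac{1}{x_n} = \frac{s}{x_1 x_2 \cdots x_n} $$ in nonzero integers $x_1, \dots, x_n$. (1) For those $(n,s)$ with $\gcd(s, M_n) = 1$, where $M_n = 1$ if $n$ is even and $M_n = 2$ if $n$ is odd, this equation has infinitely many integer solutions with at least two indices $i$ having $|x_i| \ge 2$ and with $\gcd(x_1 x_2 \cdots x_n, s) = 1$. For all remaining $(n,s)$, namely $n$ odd and $s$ even, this equation has no integer solutions with $\gcd(x_1 x_2 \cdots x_n, s) = 1$. (2) For each $n \ge 2$ there is a finite modulus $M_n^{\ast}$ such that whenever $\gcd(s, M_n^{\ast}) = 1$, this equation has infinitely many integer solutions satisfying $\min_i\{|x_i|\} \ge 2$ and $\gcd(x_1 x_2 \cdots x_n, s) = 1$. One can take $M_n^{\ast} = u_1 u_2 \cdots u_n$, where $u_i$ are the terms of Sylvester's sequence.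
   Context: Sylvester's sequence is defined by $u_1 = 2$ and $u_{n+1} = \left(\prod_{i=1}^n u_i\right) + 1$, i.e. $2, 3, 7, 43, 1807, \dots$. -}

module Defs where

open import Data.Nat as ℕ using (ℕ; zero; suc; _%_)
open import Data.Integer as ℤ using (ℤ; +_; -[1+_]; 1ℤ; 0ℤ; -1ℤ; ∣_∣)
open import Data.Rational as ℚ using (ℚ; 0ℚ; _/_)
open import Data.Vec using (Vec; foldr; map; lookup)
open import Data.Fin using (Fin)
open import Data.List using (List)
open import Data.List.Membership.Propositional using (_∉_)
open import Data.Product using (∃; _×_)
open import Data.Integer.GCD using (gcd)

-- Reciprocal of an integer as a rational; only ever applied to nonzero
-- integers (the value at 0 is an irrelevant convention).
recip : ℤ → ℚ
recip (+ zero)   = 0ℚ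
recip (+ suc n)  = 1ℤ / suc n
recip -[1+ n ]   = -1ℤ / suc n

prodℤ : ∀ {n} → Vec ℤ n → ℤ
prodℤ = foldr _ ℤ._*_ 1ℤ

sumℚ : ∀ {n} → Vec ℚ n → ℚ
sumℚ = foldr _ ℚ._+_ 0ℚ

IsSolution : ∀ {n} → ℤ → Vec ℤ n → Set
IsSolution s xs = sumℚ (map recip xs) ≡ (s / 1) ℚ.* recip (prodℤ xs)
  where open import Relation.Binary.PropositionalEquality using (_≡_)

open import Relation.Binary.PropositionalEquality using (_≡_; _≢_)
NonzeroEntries : ∀ {n} → Vec ℤ n → Set
NonzeroEntries {n} xs = (i : Fin n) → lookup xs i ≢ 0ℤ

ProdCoprime : ∀ {n} → ℤ → Vec ℤ n → Set
ProdCoprime s xs = gcd (prodℤ xs) s ≡ 1ℤ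

Infinite : ∀ {n} → (Vec ℤ n → Set) → Set
Infinite {n} P = (l : List (Vec ℤ n)) → ∃ λ xs → P xs × xs ∉ l

M : ℕ → ℕ
M n with n % 2
... | zero = 1
... | suc _ = 2

-- Sylvester's sequence: syl k = u_{k+1}, sylProd k = u₁ u₂ ⋯ u_k.
sylProd : ℕ → ℕ
syl : ℕ → ℕ
sylProd zero = 1
sylProd (suc k) = sylProd k ℕ.* syl k
syl k = sylProd k ℕ.+ 1

-- Clearing denominators turns the equation into eₙ₋₁(x) = s. For n = m + 2, the Sylvester
-- recursion P₀ = c, P_{k+1} = P_k(P_k + 1) gives the solution (s + P_m, P_{m−1} + 1, …, P₀ + 1, −c),
-- by telescoping 1/(P + 1) − 1/P = −1/(P(P + 1)). If c ≡ 1 (mod s) then P_k ≡ u₁⋯u_k (mod s),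
-- so the product of the entries is ≡ −(u₁⋯u_m)² (mod s), which is prime to s as soon as
-- gcd(s, u₁⋯uₙ) = 1; letting c grow gives infinitely many solutions, all entries of absolute
-- value ≥ 2. For part (1), n = 2, 3 is this construction (u₁⋯u_{n−2} = Mₙ), and appending the
-- entries 1, −1 passes from (n, −s) to (n + 2, s). For n odd and s even, coprimality forces every
-- xᵢ to be odd, and then eₙ₋₁(x) ≡ n ≡ 1 (mod 2).

module Submission where

open import Defs
open import Data.Nat as ℕ using (ℕ; zero; suc; _≤_; _%_; z≤n; s≤s)
import Data.Nat.Properties as ℕP
import Data.Nat.Divisibility as ℕD
import Data.Nat.GCD as ℕGCD
import Data.Nat.Coprimality as ℕC
open import Data.Nat.ListAction using (sum)
open import Data.Integer as ℤ using (ℤ; +_; -[1+_]; 0ℤ; 1ℤ; -1ℤ; ∣_∣; _+_; _*_; -_; _-_)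
import Data.Integer.Properties as ℤP
open import Data.Integer.Divisibility using (_∣_)
import Data.Integer.Divisibility.Signed as ℤD
open import Data.Integer.DivMod using (_%ℕ_; _/ℕ_; n%ℕd<d; a≡a%ℕn+[a/ℕn]*n)
open import Data.Integer.GCD using (gcd; gcd[i,j]∣i; gcd[i,j]∣j)
open import Data.Integer.Solver using (module +-*-Solver)
open import Data.Rational as ℚ using (ℚ; 1ℚ; _/_; toℚᵘ)
import Data.Rational.Properties as ℚP
import Data.Rational.Solver as ℚSolver
import Data.Rational.Unnormalised as ℚᵘ
import Data.Rational.Unnormalised.Properties as ℚᵘP
open import Data.Vec using (Vec; []; _∷_; head; tail; lookup; map)
open import Data.Fin using (Fin) renaming (zero to fzero; suc to fsuc)
import Data.Fin.Properties as FinP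
open import Data.List as List using (_∷_)
open import Data.List.Membership.Propositional using (_∈_)
open import Data.List.Membership.Propositional.Properties using (∈-map⁺)
open import Data.List.Relation.Unary.Any using (here; there)
open import Data.Product as Product using (∃; ∃₂; _×_; _,_)
open import Data.Sum using (_⊎_; inj₁; inj₂)
open import Data.Empty using (⊥-elim)
open import Function.Base using (_∘_)
open import Function.Bundles using (_⇔_; mk⇔; Equivalence)
open import Relation.Binary.PropositionalEquality
open import Relation.Nullary using (¬_)

ι : ℤ → ℚ
ι z = z / 1

toℚᵘ-ι : ∀ z → toℚᵘ (ι z) ℚᵘ.≃ ℚᵘ.mkℚᵘ z 0
toℚᵘ-ι z = ℚP.toℚᵘ-fromℚᵘ (ℚᵘ.mkℚᵘ z 0)

ι-injective : ∀ {a b} → ι a ≡ ι b → a ≡ b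
ι-injective {a} {b} eq
  with ℚᵘP.≃-trans (ℚᵘP.≃-sym (toℚᵘ-ι a)) (ℚᵘP.≃-trans (ℚP.toℚᵘ-cong eq) (toℚᵘ-ι b))
... | ℚᵘ.*≡* a*1≡b*1 = trans (sym (ℤP.*-identityʳ a)) (trans a*1≡b*1 (ℤP.*-identityʳ b))

ι-homo-+ : ∀ a b → ι (a + b) ≡ ι a ℚ.+ ι b
ι-homo-+ a b = ℚP.toℚᵘ-injective (begin
    toℚᵘ (ι (a + b))                         ≈⟨ toℚᵘ-ι (a + b) ⟩
    ℚᵘ.mkℚᵘ (a + b) 0                        ≈⟨ ℚᵘ.*≡* (solve 2 (λ a b → (a :+ b) :* con 1ℤ := (a :* con 1ℤ :+ b :* con 1ℤ) :* con 1ℤ) refl a b) ⟩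
    ℚᵘ.mkℚᵘ a 0 ℚᵘ.+ ℚᵘ.mkℚᵘ b 0             ≈⟨ ℚᵘP.+-cong (toℚᵘ-ι a) (toℚᵘ-ι b) ⟨
    toℚᵘ (ι a) ℚᵘ.+ toℚᵘ (ι b)               ≈⟨ ℚP.toℚᵘ-homo-+ (ι a) (ι b) ⟨
    toℚᵘ (ι a ℚ.+ ι b)                       ∎)
  where open ℚᵘP.≃-Reasoning; open +-*-Solver

ι-homo-* : ∀ a b → ι (a * b) ≡ ι a ℚ.* ι b
ι-homo-* a b = ℚP.toℚᵘ-injective (begin
    toℚᵘ (ι (a * b))                         ≈⟨ toℚᵘ-ι (a * b) ⟩
    ℚᵘ.mkℚᵘ (a * b) 0                        ≈⟨ ℚᵘP.*-cong (toℚᵘ-ι a) (toℚᵘ-ι b) ⟨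
    toℚᵘ (ι a) ℚᵘ.* toℚᵘ (ι b)               ≈⟨ ℚP.toℚᵘ-homo-* (ι a) (ι b) ⟨
    toℚᵘ (ι a ℚ.* ι b)                       ∎)
  where open ℚᵘP.≃-Reasoning

recip-inverseˡ : ∀ x → x ≢ 0ℤ → recip x ℚ.* ι x ≡ 1ℚ
recip-inverseˡ (+ zero) x≢0 = ⊥-elim (x≢0 refl)
recip-inverseˡ (+ suc n) _ = ℚP.toℚᵘ-injective (begin
    toℚᵘ (recip (+ suc n) ℚ.* ι (+ suc n))   ≈⟨ ℚP.toℚᵘ-homo-* (recip (+ suc n)) (ι (+ suc n)) ⟩
    toℚᵘ (recip (+ suc n)) ℚᵘ.* toℚᵘ (ι (+ suc n))
      ≈⟨ ℚᵘP.*-cong (ℚP.toℚᵘ-fromℚᵘ (ℚᵘ.mkℚᵘ 1ℤ n)) (toℚᵘ-ι (+ suc n)) ⟩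
    ℚᵘ.mkℚᵘ 1ℤ n ℚᵘ.* ℚᵘ.mkℚᵘ (+ suc n) 0   ≈⟨ ℚᵘ.*≡* (trans
      (solve 1 (λ m → (con 1ℤ :* m) :* con 1ℤ := con 1ℤ :* m) refl (+ suc n))
      (cong (λ k → 1ℤ * + k) (sym (ℕP.*-identityʳ (suc n))))) ⟩
    toℚᵘ 1ℚ                                   ∎)
  where open ℚᵘP.≃-Reasoning; open +-*-Solver
recip-inverseˡ -[1+ n ] _ = ℚP.toℚᵘ-injective (begin
    toℚᵘ (recip -[1+ n ] ℚ.* ι -[1+ n ])     ≈⟨ ℚP.toℚᵘ-homo-* (recip -[1+ n ]) (ι -[1+ n ]) ⟩
    toℚᵘ (recip -[1+ n ]) ℚᵘ.* toℚᵘ (ι -[1+ n ])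
      ≈⟨ ℚᵘP.*-cong (ℚP.toℚᵘ-fromℚᵘ (ℚᵘ.mkℚᵘ -1ℤ n)) (toℚᵘ-ι -[1+ n ]) ⟩
    ℚᵘ.mkℚᵘ -1ℤ n ℚᵘ.* ℚᵘ.mkℚᵘ -[1+ n ] 0    ≈⟨ ℚᵘ.*≡* (trans
      (solve 1 (λ m → (con -1ℤ :* (:- m)) :* con 1ℤ := con 1ℤ :* m) refl (+ suc n))
      (cong (λ k → 1ℤ * + k) (sym (ℕP.*-identityʳ (suc n))))) ⟩
    toℚᵘ 1ℚ                                   ∎)
  where open ℚᵘP.≃-Reasoning; open +-*-Solver

eₙ₋₁ : ∀ {n} → Vec ℤ n → ℤ
eₙ₋₁ []       = 0ℤ
eₙ₋₁ (x ∷ xs) = x * eₙ₋₁ xs + prodℤ xs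

prodℤ≢0 : ∀ {n} (xs : Vec ℤ n) → NonzeroEntries xs → prodℤ xs ≢ 0ℤ
prodℤ≢0 []       _  ()
prodℤ≢0 (x ∷ xs) nz x*p≡0 with ℤP.i*j≡0⇒i≡0∨j≡0 x x*p≡0
... | inj₁ x≡0 = nz fzero x≡0
... | inj₂ p≡0 = prodℤ≢0 xs (λ i → nz (fsuc i)) p≡0

sumRecip*prod≡eₙ₋₁ : ∀ {n} (xs : Vec ℤ n) → NonzeroEntries xs →
                     sumℚ (map recip xs) ℚ.* ι (prodℤ xs) ≡ ι (eₙ₋₁ xs)
sumRecip*prod≡eₙ₋₁ []       _  = refl
sumRecip*prod≡eₙ₋₁ (x ∷ xs) nz = begin
    (recip x ℚ.+ S) ℚ.* ι (x * P)                    ≡⟨ cong ((recip x ℚ.+ S) ℚ.*_) (ι-homo-* x P) ⟩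
    (recip x ℚ.+ S) ℚ.* (ι x ℚ.* ι P)                ≡⟨ distribute (recip x) S (ι x) (ι P) ⟩
    (recip x ℚ.* ι x) ℚ.* ι P ℚ.+ ι x ℚ.* (S ℚ.* ι P)
      ≡⟨ cong₂ (λ u v → u ℚ.* ι P ℚ.+ ι x ℚ.* v) (recip-inverseˡ x (nz fzero))
               (sumRecip*prod≡eₙ₋₁ xs (λ i → nz (fsuc i))) ⟩
    1ℚ ℚ.* ι P ℚ.+ ι x ℚ.* ι (eₙ₋₁ xs)               ≡⟨ cong₂ ℚ._+_ (ℚP.*-identityˡ (ι P)) (sym (ι-homo-* x (eₙ₋₁ xs))) ⟩
    ι P ℚ.+ ι (x * eₙ₋₁ xs)                          ≡⟨ ℚP.+-comm (ι P) _ ⟩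
    ι (x * eₙ₋₁ xs) ℚ.+ ι P                          ≡⟨ ι-homo-+ (x * eₙ₋₁ xs) P ⟨
    ι (eₙ₋₁ (x ∷ xs))                                ∎
  where
  open ≡-Reasoning
  S = sumℚ (map recip xs)
  P = prodℤ xs
  distribute : ∀ r S a b → (r ℚ.+ S) ℚ.* (a ℚ.* b) ≡ (r ℚ.* a) ℚ.* b ℚ.+ a ℚ.* (S ℚ.* b)
  distribute = ℚSolver.+-*-Solver.solve 4
    (λ r S a b → (r :+ S) :* (a :* b) := (r :* a) :* b :+ a :* (S :* b)) refl
    where open ℚSolver.+-*-Solver

isSolution⇔eₙ₋₁≡ : ∀ {n} s (xs : Vec ℤ n) → NonzeroEntries xs → IsSolution s xs ⇔ (eₙ₋₁ xs ≡ s)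
isSolution⇔eₙ₋₁≡ s xs nz = mk⇔ to from
  where
  open ≡-Reasoning
  S = sumℚ (map recip xs)
  P = prodℤ xs
  recipP*P≡1 : recip P ℚ.* ι P ≡ 1ℚ
  recipP*P≡1 = recip-inverseˡ P (prodℤ≢0 xs nz)
  to : IsSolution s xs → eₙ₋₁ xs ≡ s
  to S≡s/P = ι-injective (begin
    ι (eₙ₋₁ xs)                   ≡⟨ sumRecip*prod≡eₙ₋₁ xs nz ⟨
    S ℚ.* ι P                     ≡⟨ cong (ℚ._* ι P) S≡s/P ⟩
    (ι s ℚ.* recip P) ℚ.* ι P     ≡⟨ ℚP.*-assoc (ι s) (recip P) (ι P) ⟩
    ι s ℚ.* (recip P ℚ.* ι P)     ≡⟨ cong (ι s ℚ.*_) recipP*P≡1 ⟩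
    ι s ℚ.* 1ℚ                    ≡⟨ ℚP.*-identityʳ (ι s) ⟩
    ι s                           ∎)
  from : eₙ₋₁ xs ≡ s → IsSolution s xs
  from e≡s = begin
    S                             ≡⟨ ℚP.*-identityʳ S ⟨
    S ℚ.* 1ℚ                      ≡⟨ cong (S ℚ.*_) (trans (ℚP.*-comm (ι P) (recip P)) recipP*P≡1) ⟨
    S ℚ.* (ι P ℚ.* recip P)       ≡⟨ ℚP.*-assoc S (ι P) (recip P) ⟨
    (S ℚ.* ι P) ℚ.* recip P       ≡⟨ cong (ℚ._* recip P) (trans (sumRecip*prod≡eₙ₋₁ xs nz) (cong ι e≡s)) ⟩
    ι s ℚ.* recip P               ∎

open +-*-Solver

-- Coprimality carried as a Bézout certificate u a + v b = 1, which the ring solver can manipulate.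
Comaximal : ℤ → ℤ → Set
Comaximal a b = ∃₂ λ u v → u * a + v * b ≡ 1ℤ

comaximal-sym : ∀ {a b} → Comaximal a b → Comaximal b a
comaximal-sym {a} {b} (u , v , eq) = v , u , trans (ℤP.+-comm (v * b) (u * a)) eq

comaximal-neg : ∀ {a b} → Comaximal a b → Comaximal a (- b)
comaximal-neg {a} {b} (u , v , eq) =
  u , - v , trans (solve 4 (λ u v a b → u :* a :+ (:- v) :* (:- b) := u :* a :+ v :* b) refl u v a b) eq

comaximal-negˡ : ∀ {a b} → Comaximal a b → Comaximal (- a) b
comaximal-negˡ = comaximal-sym ∘ comaximal-neg ∘ comaximal-sym

comaximal-* : ∀ {a b c} → Comaximal a b → Comaximal a c → Comaximal a (b * c)
comaximal-* {a} {b} {c} (u , v , eq) (u′ , v′ , eq′) =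
  u * u′ * a + u * v′ * c + v * b * u′ , v * v′ , (begin
    (u * u′ * a + u * v′ * c + v * b * u′) * a + v * v′ * (b * c)
      ≡⟨ solve 7 (λ u v u′ v′ a b c →
           (u :* u′ :* a :+ u :* v′ :* c :+ v :* b :* u′) :* a :+ v :* v′ :* (b :* c)
           := (u :* a :+ v :* b) :* (u′ :* a :+ v′ :* c)) refl u v u′ v′ a b c ⟩
    (u * a + v * b) * (u′ * a + v′ * c)   ≡⟨ cong₂ _*_ eq eq′ ⟩
    1ℤ                                    ∎)
  where open ≡-Reasoning

comaximal-∣ : ∀ {a b c} → Comaximal a b → c ℤD.∣ b → Comaximal a c
comaximal-∣ {a} {b} {c} (u , v , eq) (ℤD.divides q b≡q*c) =
  u , v * q , trans (solve 5 (λ u a v q c → u :* a :+ v :* q :* c := u :* a :+ v :* (q :* c)) refl u a v q c)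
                    (trans (cong (λ b → u * a + v * b) (sym b≡q*c)) eq)

comaximal⇒gcd≡1 : ∀ {a b} → Comaximal a b → gcd a b ≡ 1ℤ
comaximal⇒gcd≡1 {a} {b} (u , v , eq) = cong +_ (ℕD.∣1⇒≡1 (ℤD.∣⇒∣ᵤ gcd∣1))
  where
  gcd∣1 : gcd a b ℤD.∣ 1ℤ
  gcd∣1 = subst (gcd a b ℤD.∣_) eq
    (ℤD.∣m∣n⇒∣m+n (ℤD.∣n⇒∣m*n u (ℤD.∣ᵤ⇒∣ (gcd[i,j]∣i a b))) (ℤD.∣n⇒∣m*n v (ℤD.∣ᵤ⇒∣ (gcd[i,j]∣j a b))))

comaximal-abs : ∀ {a b} → Comaximal (+ ∣ a ∣) (+ ∣ b ∣) → Comaximal a b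
comaximal-abs {a} {b} (u , v , eq) with ℤD.m∣∣m∣ {a} | ℤD.m∣∣m∣ {b}
... | ℤD.divides p ∣a∣≡p*a | ℤD.divides q ∣b∣≡q*b = u * p , v * q , (begin
    u * p * a + v * q * b     ≡⟨ solve 6 (λ u p a v q b → u :* p :* a :+ v :* q :* b := u :* (p :* a) :+ v :* (q :* b)) refl u p a v q b ⟩
    u * (p * a) + v * (q * b) ≡⟨ cong₂ (λ x y → u * x + v * y) ∣a∣≡p*a ∣b∣≡q*b ⟨
    u * + ∣ a ∣ + v * + ∣ b ∣ ≡⟨ eq ⟩
    1ℤ                        ∎)
  where open ≡-Reasoning

bézout⇒comaximal : ∀ {a b} x y → 1 ℕ.+ y ℕ.* b ≡ x ℕ.* a → Comaximal (+ a) (+ b)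
bézout⇒comaximal {a} {b} x y eq = + x , - + y , (begin
    + x * + a + - + y * + b     ≡⟨ solve 4 (λ x a y b → x :* a :+ (:- y) :* b := x :* a :- y :* b) refl (+ x) (+ a) (+ y) (+ b) ⟩
    + x * + a - + y * + b       ≡⟨ cong₂ _-_ (ℤP.pos-* x a) (ℤP.pos-* y b) ⟨
    + (x ℕ.* a) - + (y ℕ.* b)   ≡⟨ cong (λ m → + m - + (y ℕ.* b)) eq ⟨
    + (1 ℕ.+ y ℕ.* b) - + (y ℕ.* b)
      ≡⟨ solve 1 (λ m → con 1ℤ :+ m :- m := con 1ℤ) refl (+ (y ℕ.* b)) ⟩
    1ℤ                          ∎)
  where open ≡-Reasoning

gcd≡1⇒comaximal : ∀ {a b} → gcd a b ≡ 1ℤ → Comaximal a b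
gcd≡1⇒comaximal gcd≡1 with ℕC.coprime-Bézout (ℕC.gcd≡1⇒coprime (ℤP.+-injective gcd≡1))
... | ℕGCD.Bézout.+- x y eq = comaximal-abs (bézout⇒comaximal x y eq)
... | ℕGCD.Bézout.-+ x y eq = comaximal-abs (comaximal-sym (bézout⇒comaximal y x eq))

infix 4 _≡_mod_
record _≡_mod_ (a b m : ℤ) : Set where
  constructor congruent
  field
    quotient : ℤ
    a≡b+q*m  : a ≡ b + quotient * m

≡-mod-refl : ∀ {a m} → a ≡ a mod m
≡-mod-refl {a} {m} = congruent 0ℤ (solve 2 (λ a m → a := a :+ con 0ℤ :* m) refl a m)

≡-mod-sym : ∀ {a b m} → a ≡ b mod m → b ≡ a mod m
≡-mod-sym {b = b} {m} (congruent k refl) =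
  congruent (- k) (solve 3 (λ b k m → b := b :+ k :* m :+ (:- k) :* m) refl b k m)

≡-mod-trans : ∀ {a b c m} → a ≡ b mod m → b ≡ c mod m → a ≡ c mod m
≡-mod-trans {c = c} {m} (congruent k refl) (congruent l refl) =
  congruent (l + k) (solve 4 (λ c l k m → c :+ l :* m :+ k :* m := c :+ (l :+ k) :* m) refl c l k m)

≡-mod-+ : ∀ {a b c d m} → a ≡ b mod m → c ≡ d mod m → a + c ≡ b + d mod m
≡-mod-+ {b = b} {d = d} {m} (congruent k refl) (congruent l refl) =
  congruent (k + l) (solve 5 (λ b k d l m → b :+ k :* m :+ (d :+ l :* m) := b :+ d :+ (k :+ l) :* m) refl b k d l m)

≡-mod-* : ∀ {a b c d m} → a ≡ b mod m → c ≡ d mod m → a * c ≡ b * d mod m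
≡-mod-* {b = b} {d = d} {m} (congruent k refl) (congruent l refl) =
  congruent (b * l + k * d + k * l * m)
    (solve 5 (λ b k d l m → (b :+ k :* m) :* (d :+ l :* m) := b :* d :+ (b :* l :+ k :* d :+ k :* l :* m) :* m)
             refl b k d l m)

comaximal-mod : ∀ {a b c} → Comaximal a b → b ≡ c mod a → Comaximal a c
comaximal-mod {a} {b} {c} (u , v , eq) (congruent k refl) =
  u + v * k , v , trans (solve 5 (λ u v k a c → (u :+ v :* k) :* a :+ v :* c := u :* a :+ v :* (c :+ k :* a)) refl u v k a c) eq

1≢0-mod-2 : ¬ (1ℤ ≡ 0ℤ mod + 2)
1≢0-mod-2 (congruent k 1≡0+k*2) with ℕD.∣⇒≤ (ℤD.∣⇒∣ᵤ (ℤD.divides k (trans 1≡0+k*2 (ℤP.+-identityˡ (k * + 2)))))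
... | s≤s ()

parity : ∀ x → x ≡ 0ℤ mod + 2 ⊎ x ≡ 1ℤ mod + 2
parity x with x %ℕ 2 | n%ℕd<d x 2 | a≡a%ℕn+[a/ℕn]*n x 2
... | 0 | _ | x≡0+q*2 = inj₁ (congruent (x /ℕ 2) x≡0+q*2)
... | 1 | _ | x≡1+q*2 = inj₂ (congruent (x /ℕ 2) x≡1+q*2)
... | suc (suc _) | s≤s (s≤s ()) | _

odd⇒≡1-mod-2 : ∀ {n} → n % 2 ≡ 1 → + n ≡ 1ℤ mod + 2
odd⇒≡1-mod-2 {n} n%2≡1 = congruent (+ n /ℕ 2) (subst (λ r → + n ≡ + r + + n /ℕ 2 * + 2) n%2≡1 (a≡a%ℕn+[a/ℕn]*n (+ n) 2))

comaximal-2⇒odd : ∀ {x} → Comaximal x (+ 2) → x ≡ 1ℤ mod + 2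
comaximal-2⇒odd {x} coprime with parity x
... | inj₂ x≡1 = x≡1
... | inj₁ x≡0 with comaximal-mod (comaximal-sym coprime) x≡0
...   | u , v , u*2+v*0≡1 = ⊥-elim (1≢0-mod-2 (congruent u (begin
  1ℤ                    ≡⟨ u*2+v*0≡1 ⟨
  u * + 2 + v * 0ℤ      ≡⟨ solve 2 (λ u v → u :* con (+ 2) :+ v :* con 0ℤ := con 0ℤ :+ u :* con (+ 2)) refl u v ⟩
  0ℤ + u * + 2          ∎)))
  where open ≡-Reasoning

lookup∣prodℤ : ∀ {n} (xs : Vec ℤ n) i → lookup xs i ℤD.∣ prodℤ xs
lookup∣prodℤ (x ∷ xs) fzero    = ℤD.∣m⇒∣m*n (prodℤ xs) ℤD.∣-refl
lookup∣prodℤ (x ∷ xs) (fsuc i) = ℤD.∣n⇒∣m*n x (lookup∣prodℤ xs i)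

prodℤ-≡1-mod : ∀ {n m} (xs : Vec ℤ n) → (∀ i → lookup xs i ≡ 1ℤ mod m) → prodℤ xs ≡ 1ℤ mod m
prodℤ-≡1-mod []       _   = congruent 0ℤ refl
prodℤ-≡1-mod (x ∷ xs) ≡1 = ≡-mod-* (≡1 fzero) (prodℤ-≡1-mod xs (λ i → ≡1 (fsuc i)))

-- Each of the n terms of eₙ₋₁ is a product of entries, hence ≡ 1.
eₙ₋₁-≡n-mod : ∀ {n m} (xs : Vec ℤ n) → (∀ i → lookup xs i ≡ 1ℤ mod m) → eₙ₋₁ xs ≡ + n mod m
eₙ₋₁-≡n-mod []           _  = congruent 0ℤ refl
eₙ₋₁-≡n-mod {suc n} (x ∷ xs) ≡1 = subst (λ k → eₙ₋₁ (x ∷ xs) ≡ k mod _)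
  (trans (cong (_+ 1ℤ) (ℤP.*-identityˡ (+ n))) (ℤP.+-comm (+ n) 1ℤ))
  (≡-mod-+ (≡-mod-* (≡1 fzero) (eₙ₋₁-≡n-mod xs ≡1ᵗ)) (prodℤ-≡1-mod xs ≡1ᵗ))
  where
  ≡1ᵗ : ∀ i → lookup xs i ≡ 1ℤ mod _
  ≡1ᵗ i = ≡1 (fsuc i)

sylProdFrom : ℕ → ℕ → ℕ
sylProdFrom c zero    = c
sylProdFrom c (suc k) = sylProdFrom c k ℕ.* suc (sylProdFrom c k)

sylProd≡sylProdFrom1 : ∀ k → sylProd k ≡ sylProdFrom 1 k
sylProd≡sylProdFrom1 zero    = refl
sylProd≡sylProdFrom1 (suc k) =
  trans (cong (sylProd k ℕ.*_) (ℕP.+-comm (sylProd k) 1)) (cong (λ p → p ℕ.* suc p) (sylProd≡sylProdFrom1 k))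

sylProdFrom-mod : ∀ {c d m} k → + c ≡ + d mod m → + sylProdFrom c k ≡ + sylProdFrom d k mod m
sylProdFrom-mod zero    c≡d = c≡d
sylProdFrom-mod {c} {d} (suc k) c≡d =
  subst₂ (λ x y → x ≡ y mod _) (pos-P*sucP c) (pos-P*sucP d)
    (≡-mod-* P≡ (≡-mod-+ (≡-mod-refl {1ℤ}) P≡))
  where
  P≡ : + sylProdFrom c k ≡ + sylProdFrom d k mod _
  P≡ = sylProdFrom-mod k c≡d
  pos-P*sucP : ∀ e → + sylProdFrom e k * (1ℤ + + sylProdFrom e k) ≡ + sylProdFrom e (suc k)
  pos-P*sucP e = sym (ℤP.pos-* (sylProdFrom e k) (suc (sylProdFrom e k)))

sylProdFrom-≥ : ∀ c k → c ≤ sylProdFrom c k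
sylProdFrom-≥ c zero    = ℕP.≤-refl
sylProdFrom-≥ c (suc k) = ℕP.≤-trans (sylProdFrom-≥ c k) (ℕP.m≤m*n (sylProdFrom c k) (suc (sylProdFrom c k)))

sylvesterChain : (c k : ℕ) → Vec ℤ (suc k)
sylvesterChain c zero    = - + c ∷ []
sylvesterChain c (suc k) = + suc (sylProdFrom c k) ∷ sylvesterChain c k

prodℤ-sylvesterChain : ∀ c k → prodℤ (sylvesterChain c k) ≡ - + sylProdFrom c k
prodℤ-sylvesterChain c zero    = ℤP.*-identityʳ (- + c)
prodℤ-sylvesterChain c (suc k) = begin
    + suc P * prodℤ (sylvesterChain c k) ≡⟨ cong (+ suc P *_) (prodℤ-sylvesterChain c k) ⟩
    + suc P * - + P                      ≡⟨ solve 2 (λ S P → S :* (:- P) := :- (P :* S)) refl (+ suc P) (+ P) ⟩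
    - (+ P * + suc P)                    ≡⟨ cong -_ (ℤP.pos-* P (suc P)) ⟨
    - + (P ℕ.* suc P)                    ∎
  where
  open ≡-Reasoning
  P = sylProdFrom c k

eₙ₋₁-sylvesterChain : ∀ c k → eₙ₋₁ (sylvesterChain c k) ≡ 1ℤ
eₙ₋₁-sylvesterChain c zero    = solve 1 (λ x → x :* con 0ℤ :+ con 1ℤ := con 1ℤ) refl (- + c)
eₙ₋₁-sylvesterChain c (suc k) = begin
    + suc P * eₙ₋₁ (sylvesterChain c k) + prodℤ (sylvesterChain c k)
      ≡⟨ cong₂ (λ e p → + suc P * e + p) (eₙ₋₁-sylvesterChain c k) (prodℤ-sylvesterChain c k) ⟩
    (1ℤ + + P) * 1ℤ + - + P ≡⟨ solve 1 (λ P → (con 1ℤ :+ P) :* con 1ℤ :+ (:- P) := con 1ℤ) refl (+ P) ⟩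
    1ℤ                      ∎
  where
  open ≡-Reasoning
  P = sylProdFrom c k

sylvesterSolution : ℤ → (c m : ℕ) → Vec ℤ (suc (suc m))
sylvesterSolution s c m = s + + sylProdFrom c m ∷ sylvesterChain c m

eₙ₋₁-sylvesterSolution : ∀ s c m → eₙ₋₁ (sylvesterSolution s c m) ≡ s
eₙ₋₁-sylvesterSolution s c m = begin
    (s + + P) * eₙ₋₁ (sylvesterChain c m) + prodℤ (sylvesterChain c m)
      ≡⟨ cong₂ (λ e p → (s + + P) * e + p) (eₙ₋₁-sylvesterChain c m) (prodℤ-sylvesterChain c m) ⟩
    (s + + P) * 1ℤ + - + P ≡⟨ solve 2 (λ s P → (s :+ P) :* con 1ℤ :+ (:- P) := s) refl s (+ P) ⟩
    s                      ∎
  where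
  open ≡-Reasoning
  P = sylProdFrom c m

comaximal-sylvesterSolution : ∀ {s c} m → + c ≡ 1ℤ mod s → Comaximal s (+ sylProd m) →
                              Comaximal (prodℤ (sylvesterSolution s c m)) s
comaximal-sylvesterSolution {s} {c} m c≡1 coprime = comaximal-sym
  (subst (Comaximal s) (cong ((s + + P) *_) (sym (prodℤ-sylvesterChain c m)))
         (comaximal-* (comaximal-mod coprimeP P≡s+P) (comaximal-neg coprimeP)))
  where
  P = sylProdFrom c m
  coprimeP : Comaximal s (+ P)
  coprimeP = comaximal-mod coprime
    (subst (λ q → + q ≡ + P mod s) (sym (sylProd≡sylProdFrom1 m)) (sylProdFrom-mod m (≡-mod-sym c≡1)))
  P≡s+P : + P ≡ s + + P mod s
  P≡s+P = congruent -1ℤ (solve 2 (λ s P → P := s :+ P :+ con -1ℤ :* s) refl s (+ P))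

Large : ℤ → Set
Large x = 2 ≤ ∣ x ∣

large⇒nonzero : ∀ {x} → Large x → x ≢ 0ℤ
large⇒nonzero 2≤∣x∣ refl = ℕP.<⇒≱ 2≤∣x∣ z≤n

AllLarge : ∀ {n} → Vec ℤ n → Set
AllLarge {n} xs = (i : Fin n) → Large (lookup xs i)

TwoLarge : ∀ {n} → Vec ℤ n → Set
TwoLarge {n} xs = ∃₂ λ (i j : Fin n) → i ≢ j × Large (lookup xs i) × Large (lookup xs j)

≤∣s+P∣ : ∀ {t} s P → t ℕ.+ ∣ s ∣ ≤ P → t ≤ ∣ s + + P ∣
≤∣s+P∣ {t} s P t+∣s∣≤P = ℕP.+-cancelʳ-≤ (∣ s ∣) t (∣ s + + P ∣) (ℕP.≤-trans t+∣s∣≤P P≤)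
  where
  P≤ : P ≤ ∣ s + + P ∣ ℕ.+ ∣ s ∣
  P≤ = subst (λ x → ∣ x ∣ ≤ ∣ s + + P ∣ ℕ.+ ∣ s ∣) (solve 2 (λ s P → s :+ P :- s := P) refl s (+ P))
             (ℤP.∣i-j∣≤∣i∣+∣j∣ (s + + P) s)

sylvesterChain-large : ∀ {c} k → 2 ≤ c → AllLarge (sylvesterChain c k)
sylvesterChain-large {c} zero    2≤c fzero    = subst (2 ≤_) (sym (ℤP.∣-i∣≡∣i∣ (+ c))) 2≤c
sylvesterChain-large {c} (suc k) 2≤c fzero    =
  ℕP.≤-trans 2≤c (ℕP.≤-trans (sylProdFrom-≥ c k) (ℕP.n≤1+n (sylProdFrom c k)))
sylvesterChain-large     (suc k) 2≤c (fsuc i) = sylvesterChain-large k 2≤c i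

sylvesterSolution-large : ∀ {s c} m → 2 ℕ.+ ∣ s ∣ ≤ c → AllLarge (sylvesterSolution s c m)
sylvesterSolution-large {s} {c} m 2+∣s∣≤c fzero    = ≤∣s+P∣ s _ (ℕP.≤-trans 2+∣s∣≤c (sylProdFrom-≥ c m))
sylvesterSolution-large         m 2+∣s∣≤c (fsuc i) = sylvesterChain-large m (ℕP.≤-trans (ℕP.m≤m+n 2 _) 2+∣s∣≤c) i

unbounded⇒infinite : ∀ {n} {P : Vec ℤ n → Set} (f : ℕ → Vec ℤ n) (g : Vec ℤ n → ℕ) →
                     (∀ t → P (f t)) → (∀ t → t ≤ g (f t)) → Infinite P
unbounded⇒infinite f g P[f] t≤g[f] l = f B , P[f] B , λ f[B]∈l → ℕP.<⇒≱ (ℕP.n<1+n _) (ℕP.≤-trans (t≤g[f] B) (g≤sum l f[B]∈l))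
  where
  g≤sum : ∀ {xs} l → xs ∈ l → g xs ≤ sum (List.map g l)
  g≤sum (ys ∷ l) (here refl)  = ℕP.m≤m+n (g ys) _
  g≤sum (ys ∷ l) (there xs∈l) = ℕP.≤-trans (g≤sum l xs∈l) (ℕP.m≤n+m _ (g ys))
  B = suc (sum (List.map g l))

infinite-mono : ∀ {n} {P Q : Vec ℤ n → Set} → (∀ xs → P xs → Q xs) → Infinite P → Infinite Q
infinite-mono P⇒Q infP l with infP l
... | xs , Pxs , xs∉l = xs , P⇒Q xs Pxs , xs∉l

infinite-retract : ∀ {m n} {P : Vec ℤ m → Set} {Q : Vec ℤ n → Set}
                   (f : Vec ℤ m → Vec ℤ n) (r : Vec ℤ n → Vec ℤ m) → (∀ xs → r (f xs) ≡ xs) →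
                   (∀ {xs} → P xs → Q (f xs)) → Infinite P → Infinite Q
infinite-retract f r r∘f≡id P⇒Q[f] infP l with infP (List.map r l)
... | xs , Pxs , xs∉r[l] = f xs , P⇒Q[f] Pxs , λ f[xs]∈l → xs∉r[l] (subst (_∈ List.map r l) (r∘f≡id xs) (∈-map⁺ r f[xs]∈l))

CoprimeSolution : ∀ {n} → ℤ → Vec ℤ n → Set
CoprimeSolution s xs = NonzeroEntries xs × eₙ₋₁ xs ≡ s × Comaximal (prodℤ xs) s

-- c ≡ 1 (mod s) makes the solution coprime to s; the factor |s| + t + 1 makes it large and unbounded in t.
seed : ℤ → ℕ → ℕ
seed s t = suc (∣ s ∣ ℕ.* suc (∣ s ∣ ℕ.+ t))

seed≡1-mod : ∀ s t → + seed s t ≡ 1ℤ mod s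
seed≡1-mod s t with ℤD.m∣∣m∣ {s}
... | ℤD.divides q ∣s∣≡q*s = congruent (q * + N) (begin
    1ℤ + + (∣ s ∣ ℕ.* N)   ≡⟨ cong (λ a → 1ℤ + a) (ℤP.pos-* ∣ s ∣ N) ⟩
    1ℤ + + ∣ s ∣ * + N     ≡⟨ cong (λ a → 1ℤ + a * + N) ∣s∣≡q*s ⟩
    1ℤ + q * s * + N       ≡⟨ solve 3 (λ q s N → con 1ℤ :+ q :* s :* N := con 1ℤ :+ q :* N :* s) refl q s (+ N) ⟩
    1ℤ + q * + N * s       ∎)
  where
  open ≡-Reasoning
  N = suc (∣ s ∣ ℕ.+ t)

seed-≥ : ∀ {s} t → s ≢ 0ℤ → 2 ℕ.+ t ℕ.+ ∣ s ∣ ≤ seed s t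
seed-≥ {s} t s≢0 = s≤s (ℕP.≤-trans (s≤s (ℕP.≤-reflexive (ℕP.+-comm t ∣ s ∣)))
                                   (ℕP.m≤n*m (suc (∣ s ∣ ℕ.+ t)) ∣ s ∣ {{ℤ.≢-nonZero s≢0}}))

infinitely-many-large-coprime-solutions : ∀ m {s} → s ≢ 0ℤ → Comaximal s (+ sylProd m) →
  Infinite {suc (suc m)} (λ xs → CoprimeSolution s xs × AllLarge xs)
infinitely-many-large-coprime-solutions m {s} s≢0 coprime =
  unbounded⇒infinite (λ t → sylvesterSolution s (seed s t) m) (λ xs → ∣ head xs ∣) solution unbounded
  where
  c≥ : ∀ t → 2 ℕ.+ t ℕ.+ ∣ s ∣ ≤ sylProdFrom (seed s t) m
  c≥ t = ℕP.≤-trans (seed-≥ t s≢0) (sylProdFrom-≥ (seed s t) m)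
  solution : ∀ t → CoprimeSolution s (sylvesterSolution s (seed s t) m) × AllLarge (sylvesterSolution s (seed s t) m)
  solution t = ((λ i → large⇒nonzero (large i)) , eₙ₋₁-sylvesterSolution s (seed s t) m
              , comaximal-sylvesterSolution m (seed≡1-mod s t) coprime) , large
    where
    large : AllLarge (sylvesterSolution s (seed s t) m)
    large = sylvesterSolution-large {s} m (ℕP.≤-trans (s≤s (s≤s (ℕP.m≤n+m ∣ s ∣ t))) (seed-≥ t s≢0))
  unbounded : ∀ t → t ≤ ∣ head (sylvesterSolution s (seed s t) m) ∣
  unbounded t = ≤∣s+P∣ s _ (ℕP.≤-trans (ℕP.m≤n+m _ 2) (c≥ t))

allLarge⇒twoLarge : ∀ {m} (xs : Vec ℤ (suc (suc m))) → AllLarge xs → TwoLarge xs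
allLarge⇒twoLarge _ large = fzero , fsuc fzero , (λ ()) , large fzero , large (fsuc fzero)

pad : ∀ {n} → Vec ℤ n → Vec ℤ (suc (suc n))
pad xs = 1ℤ ∷ -1ℤ ∷ xs

-- Since 1/1 + 1/(-1) = 0, padding only flips the sign of both sides.
coprimeSolution-pad : ∀ {n s} {xs : Vec ℤ n} → CoprimeSolution (- s) xs → CoprimeSolution s (pad xs)
coprimeSolution-pad {s = s} {xs} (nz , e≡-s , coprime) = nz′ , e≡s , coprime′
  where
  nz′ : NonzeroEntries (pad xs)
  nz′ fzero               = λ ()
  nz′ (fsuc fzero)        = λ ()
  nz′ (fsuc (fsuc i))     = nz i
  e≡s : eₙ₋₁ (pad xs) ≡ s
  e≡s = trans (solve 2 (λ E P → con 1ℤ :* (con -1ℤ :* E :+ P) :+ con -1ℤ :* P := :- E) refl (eₙ₋₁ xs) (prodℤ xs))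
              (trans (cong -_ e≡-s) (ℤP.neg-involutive s))
  coprime′ : Comaximal (prodℤ (pad xs)) s
  coprime′ = subst₂ Comaximal (solve 1 (λ P → :- P := con 1ℤ :* (con -1ℤ :* P)) refl (prodℤ xs)) (ℤP.neg-involutive s)
                    (comaximal-neg (comaximal-negˡ coprime))

twoLarge-pad : ∀ {n} {xs : Vec ℤ n} → TwoLarge xs → TwoLarge (pad xs)
twoLarge-pad (i , j , i≢j , large-i , large-j) =
  fsuc (fsuc i) , fsuc (fsuc j) , (λ eq → i≢j (FinP.suc-injective (FinP.suc-injective eq))) , large-i , large-j

infinitely-many-coprime-solutions-with-two-large : ∀ m {s} → s ≢ 0ℤ → Comaximal s (+ M (suc (suc m))) →
  Infinite {suc (suc m)} (λ xs → CoprimeSolution s xs × TwoLarge xs)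
infinitely-many-coprime-solutions-with-two-large zero    s≢0 coprime =
  infinite-mono (λ xs → Product.map₂ (allLarge⇒twoLarge xs)) (infinitely-many-large-coprime-solutions 0 s≢0 coprime)
infinitely-many-coprime-solutions-with-two-large (suc zero) s≢0 coprime =
  infinite-mono (λ xs → Product.map₂ (allLarge⇒twoLarge xs)) (infinitely-many-large-coprime-solutions 1 s≢0 coprime)
infinitely-many-coprime-solutions-with-two-large (suc (suc m)) s≢0 coprime =
  infinite-retract pad (tail ∘ tail) (λ _ → refl) (Product.map coprimeSolution-pad twoLarge-pad)
    (infinitely-many-coprime-solutions-with-two-large m (s≢0 ∘ ℤP.neg-injective) (comaximal-negˡ coprime))

no-coprime-solution-for-odd-n : ∀ {n s} (xs : Vec ℤ n) → n % 2 ≡ 1 → + 2 ℤD.∣ s → ¬ CoprimeSolution s xs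
no-coprime-solution-for-odd-n {s = s} xs n-odd 2∣s@(ℤD.divides q s≡q*2) (_ , e≡s , coprime) =
  1≢0-mod-2 (≡-mod-trans (≡-mod-sym s≡1) s≡0)
  where
  coprime-2 : Comaximal (prodℤ xs) (+ 2)
  coprime-2 = comaximal-∣ coprime 2∣s
  entries-odd : ∀ i → lookup xs i ≡ 1ℤ mod + 2
  entries-odd i = comaximal-2⇒odd (comaximal-sym (comaximal-∣ (comaximal-sym coprime-2) (lookup∣prodℤ xs i)))
  s≡1 : s ≡ 1ℤ mod + 2
  s≡1 = subst (λ e → e ≡ 1ℤ mod + 2) e≡s (≡-mod-trans (eₙ₋₁-≡n-mod xs entries-odd) (odd⇒≡1-mod-2 n-odd))
  s≡0 : s ≡ 0ℤ mod + 2
  s≡0 = congruent q (trans s≡q*2 (sym (ℤP.+-identityˡ (q * + 2))))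

sylProd-∣ : ∀ m k → sylProd m ℕD.∣ sylProd (k ℕ.+ m)
sylProd-∣ m zero    = ℕD.∣-refl
sylProd-∣ m (suc k) = ℕD.∣m⇒∣m*n (syl (k ℕ.+ m)) (sylProd-∣ m k)

coprimeSolution⇒statement : ∀ {n s} {Extra : Vec ℤ n → Set} xs → CoprimeSolution s xs × Extra xs →
                            NonzeroEntries xs × IsSolution s xs × Extra xs × ProdCoprime s xs
coprimeSolution⇒statement xs ((nz , e≡s , coprime) , extra) =
  nz , Equivalence.from (isSolution⇔eₙ₋₁≡ _ xs nz) e≡s , extra , comaximal⇒gcd≡1 coprime

theorem4p2 :
    -- (1a) gcd(s, M_n) = 1: infinitely many solutions with two |x_i| ≥ 2 and gcd(x₁⋯xₙ, s) = 1
    ((n : ℕ) (s : ℤ) → 2 ≤ n → s ≢ 0ℤ → gcd s (+ M n) ≡ 1ℤ →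
      Infinite {n} (λ xs → NonzeroEntries xs × IsSolution s xs
        × (∃₂ λ (i j : Fin n) → i ≢ j × 2 ≤ ∣ lookup xs i ∣ × 2 ≤ ∣ lookup xs j ∣)
        × ProdCoprime s xs))
    -- (1b) n odd and s even: no solution with gcd(x₁⋯xₙ, s) = 1
    × ((n : ℕ) (s : ℤ) → 2 ≤ n → s ≢ 0ℤ → n % 2 ≡ 1 → (+ 2) ∣ s →
      ¬ (∃ λ (xs : Vec ℤ n) → NonzeroEntries xs × IsSolution s xs × ProdCoprime s xs))
    -- (2) gcd(s, u₁⋯uₙ) = 1: infinitely many solutions with min |x_i| ≥ 2 and gcd(x₁⋯xₙ, s) = 1
    × ((n : ℕ) (s : ℤ) → 2 ≤ n → s ≢ 0ℤ → gcd s (+ sylProd n) ≡ 1ℤ →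
      Infinite {n} (λ xs → NonzeroEntries xs × IsSolution s xs
        × ((i : Fin n) → 2 ≤ ∣ lookup xs i ∣)
        × ProdCoprime s xs))
theorem4p2 =
    (λ { zero _ () ; (suc zero) _ (s≤s ()) ; (suc (suc m)) s _ s≢0 gcd≡1 →
         infinite-mono coprimeSolution⇒statement
           (infinitely-many-coprime-solutions-with-two-large m s≢0 (gcd≡1⇒comaximal gcd≡1)) })
  , (λ n s _ _ n-odd 2∣s (xs , nz , solution , gcd≡1) →
         no-coprime-solution-for-odd-n xs n-odd (ℤD.∣ᵤ⇒∣ 2∣s)
           (nz , Equivalence.to (isSolution⇔eₙ₋₁≡ s xs nz) solution , gcd≡1⇒comaximal gcd≡1))
  , (λ { zero _ () ; (suc zero) _ (s≤s ()) ; (suc (suc m)) s _ s≢0 gcd≡1 →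
         infinite-mono coprimeSolution⇒statement
           (infinitely-many-large-coprime-solutions m s≢0
             (comaximal-∣ (gcd≡1⇒comaximal gcd≡1) (ℤD.∣ᵤ⇒∣ {+ sylProd m} {+ sylProd (suc (suc m))} (sylProd-∣ m 2)))) })
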